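{- Let $X$ be a finite set with $|X|=n$, let $d\ge k\ge 1$ be integers, and let $S\subseteq X^d$ be an orthogonal array of degree $d$ and strength $k$ on $X$. Let $c:X\to[1,r]$ be an $r$-coloring of $X$ with color classes $X_1,\dots,X_r$ and densities $c_i=|X_i|/n$. For every vector $\mathbf{v}=(v_1,\dots,v_r)$ of nonnegative integers with $|\mathbf{v}|=d$, let $s(\mathbf{v})$ be the number of vectors in $S$ having exactly $v_i$ coordinates in $X_i$ for each $i=1,\dots,r$. Then for every vector $\mathbf{u}=(u_1,\dots,u_r)$ of nonnegative integers with $|\mathbf{u}|\le k$, $$\frac{1}{n^{k}}\sum_{|\mathbf{v}|=d}{\mathbf{v}\choose \mathbf{u}}\,s(\mathbf{v})={d\choose \mathbf{u}}\,c_1^{u_1}\cdots c_r^{u_r},$$ where the sum runs over all vectors $\mathbf{v}$ of nonnegative integers with $|\mathbf{v}|=d$.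
   Context: A set $S$ of $d$-vectors with entries in $X$ is an orthogonal array of degree $d$ and strength $k$ (an $OA(d,k)$) on $X$ if for every choice of indices $1\le i_1<\dots<i_k\le d$ and every $(a_1,\dots,a_k)\in X^k$ there is exactly one vector $(y_1,\dots,y_d)\in S$ with $y_{i_j}=a_j$ for all $j$. For a vector $\mathbf{u}=(u_1,\dots,u_r)$ of nonnegative integers, $|\mathbf{u}|=\sum_i u_i$; ${d\choose \mathbf{u}}$ denotes the multinomial coefficient $\frac{d!}{u_1!\cdots u_r!\,(d-|\mathbf{u}|)!}$; and ${\mathbf{v}\choose\mathbf{u}}=\prod_{i=1}^r{v_i\choose u_i}$, with the conventions ${v\choose u}=0$ if $v<u$ and ${0\choose 0}=1$. -}

module Defs where

open import Data.Nat as ℕ using (ℕ; zero; suc; NonZero; _∸_)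
open import Data.Nat.Properties using (_!≢0; m*n≢0)
open import Data.Nat.Combinatorics using (_C_)
open import Data.Nat.Base using (_!)
open import Data.Fin as Fin using (Fin)
open import Data.Fin.Properties using () renaming (_≟_ to _≟ᶠ_)
open import Data.Vec as Vec using (Vec; []; _∷_; lookup; tabulate; toList)
open import Data.Vec.Properties using (≡-dec)
open import Data.List as List using (List; length; filter; concatMap; upTo; allFin)
open import Data.Nat.ListAction as NL using ()
open import Data.Integer using (+_)
open import Data.Rational as ℚ using (ℚ; _/_)
open import Relation.Binary.PropositionalEquality using (_≡_)

restrict : ∀ {n d k} → (Fin k → Fin d) → Vec (Fin n) d → Vec (Fin n) k
restrict ι y = tabulate (λ j → lookup y (ι j))

StrictlyIncreasing : ∀ {k d} → (Fin k → Fin d) → Set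
StrictlyIncreasing ι = ∀ i j → i Fin.< j → ι i Fin.< ι j

-- S (a finite set, given as a list of its elements) is an OA(d,k) on X = Fin n:
-- for every i₁<…<i_k and every (a₁,…,a_k) ∈ X^k exactly one y ∈ S restricts to a.
IsOA : (n d k : ℕ) → List (Vec (Fin n) d) → Set
IsOA n d k S =
  (ι : Fin k → Fin d) → StrictlyIncreasing ι → (a : Vec (Fin n) k) →
  length (filter (λ y → ≡-dec _≟ᶠ_ (restrict ι y) a) S) ≡ 1

classSize : ∀ {n r} → (Fin n → Fin r) → Fin r → ℕ
classSize {n} c i = length (filter (λ x → c x ≟ᶠ i) (allFin n))

profile : ∀ {n d r} → (Fin n → Fin r) → Vec (Fin n) d → Vec ℕ r
profile c y = tabulate (λ i → length (filter (λ x → c x ≟ᶠ i) (toList y)))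

s : ∀ {n d r} → (Fin n → Fin r) → List (Vec (Fin n) d) → Vec ℕ r → ℕ
s c S v = length (filter (λ y → ≡-dec ℕ._≟_ (profile c y) v) S)

boxVecs : (r b : ℕ) → List (Vec ℕ r)
boxVecs zero    b = [] List.∷ List.[]
boxVecs (suc r) b = concatMap (λ x → List.map (x ∷_) (boxVecs r b)) (upTo (suc b))

compositions : (r d : ℕ) → List (Vec ℕ r)
compositions r d = filter (λ v → Vec.sum v ℕ.≟ d) (boxVecs r d)

vecChoose : ∀ {r} → Vec ℕ r → Vec ℕ r → ℕ
vecChoose v u = NL.product (toList (Vec.zipWith _C_ v u))

factProd : ∀ {r} → Vec ℕ r → ℕ
factProd [] = 1
factProd (x ∷ u) = (x !) ℕ.* factProd u

instance
  factProd-nz : ∀ {r} {u : Vec ℕ r} → NonZero (factProd u)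
  factProd-nz {u = []} = _
  factProd-nz {u = x ∷ u} = m*n≢0 (x !) (factProd u) {{x !≢0}} {{factProd-nz {u = u}}}

  fact-nz : ∀ {m} → NonZero (m !)
  fact-nz {m} = m !≢0

-- multinomial (d choose u) = d! / (u₁! ⋯ u_r! (d - |u|)!)   (as a rational)
multinom : ∀ {r} → ℕ → Vec ℕ r → ℚ
multinom d u =
  _/_ (+ (d !)) (factProd u ℕ.* ((d ∸ Vec.sum u) !)) {{m*n≢0 (factProd u) ((d ∸ Vec.sum u) !) {{factProd-nz {u = u}}} {{(d ∸ Vec.sum u) !≢0}}}}

_^ℚ_ : ℚ → ℕ → ℚ
q ^ℚ zero  = ℚ.1ℚ
q ^ℚ suc m = q ℚ.* (q ^ℚ m)

prodℚ : List ℚ → ℚ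
prodℚ = List.foldr ℚ._*_ ℚ.1ℚ

sumℚ : List ℚ → ℚ
sumℚ = List.foldr ℚ._+_ ℚ.0ℚ

ℕ→ℚ : ℕ → ℚ
ℕ→ℚ m = (+ m) / 1

module Submission where

-- Grouping the points of S by their colour profile,
--   Σ_{|v|=d} (v choose u) s(v) = Σ_{y ∈ S} (profile y choose u),
-- and (profile y choose u) is the number of colour patterns of type u that y matches: vectors
-- of coordinate constraints prescribing colour i on exactly uᵢ coordinates, the others free.
-- Exchanging the two sums, each pattern is matched by exactly n^(k-|u|) ∏ᵢ |Xᵢ|^uᵢ points of S:
-- a colour constraint is the disjoint union of the point constraints it allows, and an orthogonal
-- array of strength k has index n^(k-m) on any m ≤ k coordinates.  Finally, there are
-- d!/(u₁!⋯u_r!(d-|u|)!) patterns of type u.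

open import Defs

module Combinatorics where

  open import Data.Bool.Base using (true; false; if_then_else_)
  open import Data.Fin as Fin using (Fin)
  open import Data.Fin.Properties using () renaming (_≟_ to _≟ᶠ_)
  open import Data.List as List using (List; []; _∷_; _++_; map; concatMap; filter; length; allFin; upTo)
  import Data.List.Properties as List
  open import Data.List.Membership.Propositional using (_∈_)
  open import Data.List.Membership.Propositional.Properties using (∈-allFin; ∈-upTo⁺)
  open import Data.List.Relation.Unary.All as All using (All; []; _∷_)
  import Data.List.Relation.Unary.All.Properties as All
  open import Data.List.Relation.Unary.Any using (here; there)
  open import Data.List.Relation.Unary.Unique.Propositional using (Unique; []; _∷_)
  open import Data.List.Relation.Unary.Unique.Propositional.Properties using (allFin⁺; upTo⁺)
  open import Data.Nat as ℕ using (ℕ; zero; suc; _+_; _*_; _∸_; _^_; _≤_; _<_; _!; s≤s; z≤n)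
  open import Data.Nat.Properties
  open import Algebra.Properties.CommutativeSemigroup +-commutativeSemigroup
    using () renaming (x∙yz≈y∙xz to +-swap; interchange to +-interchange)
  open import Algebra.Properties.CommutativeSemigroup *-commutativeSemigroup
    using () renaming (x∙yz≈y∙xz to *-swap)
  open import Data.Nat.Combinatorics using (_C_; nCk+nC[k+1]≡[n+1]C[k+1])
  open import Data.Nat.Tactic.RingSolver using (solve-∀)
  open import Data.Product using (∃; ∃₂; _×_; _,_; proj₁; proj₂)
  open import Data.Vec as Vec using (Vec; []; _∷_; lookup; sum; tabulate; toList; _[_]%=_; _[_]≔_)
  open import Data.Vec.Functional using () renaming (_∷_ to _∷ᶠ_)
  open import Data.Vec.Properties using (≡-dec; tabulate-cong; lookup∘updateAt)
  open import Function using (_∘_)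
  open import Relation.Binary.Definitions using (DecidableEquality)
  open import Relation.Binary.PropositionalEquality
  open import Relation.Nullary using (Dec; yes; no; does; _×-dec_; contradiction)
  open import Relation.Unary using (Decidable)
  open ≡-Reasoning

  𝟙 : ∀ {p} {P : Set p} → Dec P → ℕ
  𝟙 P? = if does P? then 1 else 0

  𝟙-yes : ∀ {p} {P : Set p} (P? : Dec P) → P → 𝟙 P? ≡ 1
  𝟙-yes (yes _) _ = refl
  𝟙-yes (no ¬P) P = contradiction P ¬P

  𝟙-×-dec : ∀ {p q} {P : Set p} {Q : Set q} (P? : Dec P) (Q? : Dec Q) → 𝟙 (P? ×-dec Q?) ≡ 𝟙 P? * 𝟙 Q?
  𝟙-×-dec (yes _) Q? = sym (+-identityʳ (𝟙 Q?))
  𝟙-×-dec (no _)  Q? = refl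

  ∑ : ∀ {a} {A : Set a} → List A → (A → ℕ) → ℕ
  ∑ []       f = 0
  ∑ (x ∷ xs) f = f x + ∑ xs f

  module _ {a} {A : Set a} where

    ∑-cong : ∀ (xs : List A) {f g : A → ℕ} → (∀ x → f x ≡ g x) → ∑ xs f ≡ ∑ xs g
    ∑-cong []       f≗g = refl
    ∑-cong (x ∷ xs) f≗g = cong₂ _+_ (f≗g x) (∑-cong xs f≗g)

    ∑-congᴬ : ∀ {xs : List A} {f g : A → ℕ} → All (λ x → f x ≡ g x) xs → ∑ xs f ≡ ∑ xs g
    ∑-congᴬ []            = refl
    ∑-congᴬ (fx≡gx ∷ eqs) = cong₂ _+_ fx≡gx (∑-congᴬ eqs)

    ∑-+ : ∀ (xs : List A) (f g : A → ℕ) → ∑ xs (λ x → f x + g x) ≡ ∑ xs f + ∑ xs g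
    ∑-+ []       f g = refl
    ∑-+ (x ∷ xs) f g = begin
      f x + g x + ∑ xs (λ x → f x + g x) ≡⟨ cong (f x + g x +_) (∑-+ xs f g) ⟩
      f x + g x + (∑ xs f + ∑ xs g)      ≡⟨ +-interchange (f x) (g x) (∑ xs f) (∑ xs g) ⟩
      f x + ∑ xs f + (g x + ∑ xs g)      ∎

    ∑-*ˡ : ∀ c (xs : List A) (f : A → ℕ) → ∑ xs (λ x → c * f x) ≡ c * ∑ xs f
    ∑-*ˡ c []       f = sym (*-zeroʳ c)
    ∑-*ˡ c (x ∷ xs) f = trans (cong (c * f x +_) (∑-*ˡ c xs f)) (sym (*-distribˡ-+ c (f x) _))

    ∑-*ʳ : ∀ c (xs : List A) (f : A → ℕ) → ∑ xs (λ x → f x * c) ≡ ∑ xs f * c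
    ∑-*ʳ c xs f = begin
      ∑ xs (λ x → f x * c) ≡⟨ ∑-cong xs (λ x → *-comm (f x) c) ⟩
      ∑ xs (λ x → c * f x) ≡⟨ ∑-*ˡ c xs f ⟩
      c * ∑ xs f           ≡⟨ *-comm c _ ⟩
      ∑ xs f * c           ∎

    ∑-const : ∀ (xs : List A) c → ∑ xs (λ _ → c) ≡ length xs * c
    ∑-const []       c = refl
    ∑-const (x ∷ xs) c = cong (c +_) (∑-const xs c)

    ∑-0 : ∀ (xs : List A) → ∑ xs (λ _ → 0) ≡ 0
    ∑-0 xs = trans (∑-const xs 0) (*-zeroʳ (length xs))

    ∑-++ : ∀ (xs ys : List A) (f : A → ℕ) → ∑ (xs ++ ys) f ≡ ∑ xs f + ∑ ys f
    ∑-++ []       ys f = refl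
    ∑-++ (x ∷ xs) ys f = trans (cong (f x +_) (∑-++ xs ys f)) (sym (+-assoc (f x) _ _))

    ∑-filter : ∀ {p} {P : A → Set p} (P? : Decidable P) (xs : List A) (f : A → ℕ) →
      ∑ (filter P? xs) f ≡ ∑ xs (λ x → 𝟙 (P? x) * f x)
    ∑-filter P? []       f = refl
    ∑-filter P? (x ∷ xs) f with does (P? x)
    ... | true  = cong₂ _+_ (sym (+-identityʳ (f x))) (∑-filter P? xs f)
    ... | false = ∑-filter P? xs f

    length-filter : ∀ {p} {P : A → Set p} (P? : Decidable P) (xs : List A) →
      length (filter P? xs) ≡ ∑ xs (λ x → 𝟙 (P? x))
    length-filter P? []       = refl
    length-filter P? (x ∷ xs) with does (P? x)
    ... | true  = cong suc (length-filter P? xs)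
    ... | false = length-filter P? xs

    ∑-pick : ∀ (_≟_ : DecidableEquality A) {xs : List A} → Unique xs → ∀ {p} → p ∈ xs →
      (g : A → ℕ) → ∑ xs (λ x → 𝟙 (p ≟ x) * g x) ≡ g p
    ∑-pick _≟_ {x ∷ xs} (x∉xs ∷ _) {p} (here refl) g = begin
      𝟙 (p ≟ p) * g p + ∑ xs (λ y → 𝟙 (p ≟ y) * g y) ≡⟨ cong₂ _+_ (cong (_* g p) (𝟙-yes (p ≟ p) refl)) (elsewhere xs x∉xs) ⟩
      1 * g p + 0                                    ≡⟨ trans (+-identityʳ _) (*-identityˡ (g p)) ⟩
      g p                                            ∎
      where
      elsewhere : ∀ ys → All (λ y → p ≢ y) ys → ∑ ys (λ y → 𝟙 (p ≟ y) * g y) ≡ 0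
      elsewhere []       []           = refl
      elsewhere (y ∷ ys) (p≢y ∷ p≢ys) with p ≟ y
      ... | yes p≡y = contradiction p≡y p≢y
      ... | no  _   = elsewhere ys p≢ys
    ∑-pick _≟_ {x ∷ xs} (x∉xs ∷ uniq) {p} (there p∈xs) g with p ≟ x
    ... | yes refl = contradiction refl (All.lookup x∉xs p∈xs)
    ... | no  _    = ∑-pick _≟_ uniq p∈xs g

  module _ {a b} {A : Set a} {B : Set b} where

    ∑-map : ∀ (f : A → B) (xs : List A) (g : B → ℕ) → ∑ (map f xs) g ≡ ∑ xs (g ∘ f)
    ∑-map f []       g = refl
    ∑-map f (x ∷ xs) g = cong (g (f x) +_) (∑-map f xs g)

    ∑-concatMap : ∀ (f : A → List B) (xs : List A) (g : B → ℕ) →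
      ∑ (concatMap f xs) g ≡ ∑ xs (λ x → ∑ (f x) g)
    ∑-concatMap f []       g = refl
    ∑-concatMap f (x ∷ xs) g = trans (∑-++ (f x) _ g) (cong (∑ (f x) g +_) (∑-concatMap f xs g))

    ∑-swap : ∀ (xs : List A) (ys : List B) (h : A → B → ℕ) →
      ∑ xs (λ x → ∑ ys (h x)) ≡ ∑ ys (λ y → ∑ xs (λ x → h x y))
    ∑-swap []       ys h = sym (∑-0 ys)
    ∑-swap (x ∷ xs) ys h = begin
      ∑ ys (h x) + ∑ xs (λ x → ∑ ys (h x))         ≡⟨ cong (∑ ys (h x) +_) (∑-swap xs ys h) ⟩
      ∑ ys (h x) + ∑ ys (λ y → ∑ xs (λ x → h x y)) ≡⟨ sym (∑-+ ys (h x) _) ⟩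
      ∑ ys (λ y → h x y + ∑ xs (λ x → h x y))      ∎

  ∑-group : ∀ {A B : Set} (_≟_ : DecidableEquality B) (key : A → B) (V : List B) (f : B → ℕ) (xs : List A) →
    (∀ x → ∑ V (λ v → 𝟙 (key x ≟ v)) ≡ 1) →
    ∑ V (λ v → f v * length (filter (λ x → key x ≟ v) xs)) ≡ ∑ xs (λ x → f (key x))
  ∑-group _≟_ key V f xs once = begin
    ∑ V (λ v → f v * length (filter (λ x → key x ≟ v) xs)) ≡⟨ ∑-cong V (λ v → cong (f v *_) (length-filter (λ x → key x ≟ v) xs)) ⟩
    ∑ V (λ v → f v * ∑ xs (λ x → 𝟙 (key x ≟ v)))          ≡⟨ ∑-cong V (λ v → sym (∑-*ˡ (f v) xs _)) ⟩
    ∑ V (λ v → ∑ xs (λ x → f v * 𝟙 (key x ≟ v)))          ≡⟨ ∑-swap V xs _ ⟩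
    ∑ xs (λ x → ∑ V (λ v → f v * 𝟙 (key x ≟ v)))          ≡⟨ ∑-cong xs (λ x → ∑-cong V (at-key x)) ⟩
    ∑ xs (λ x → ∑ V (λ v → f (key x) * 𝟙 (key x ≟ v)))    ≡⟨ ∑-cong xs (λ x → ∑-*ˡ (f (key x)) V _) ⟩
    ∑ xs (λ x → f (key x) * ∑ V (λ v → 𝟙 (key x ≟ v)))    ≡⟨ ∑-cong xs (λ x → trans (cong (f (key x) *_) (once x)) (*-identityʳ _)) ⟩
    ∑ xs (λ x → f (key x))                                ∎
    where
    at-key : ∀ x v → f v * 𝟙 (key x ≟ v) ≡ f (key x) * 𝟙 (key x ≟ v)
    at-key x v with key x ≟ v
    ... | yes refl = refl
    ... | no  _    = trans (*-zeroʳ (f v)) (sym (*-zeroʳ (f (key x))))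

  -- Colour-count vectors u ∈ ℕ^r record how often each of r colours is used;
  -- u [ i ]%= suc uses colour i once more.

  zeros : ∀ {r} → Vec ℕ r
  zeros = Vec.replicate _ 0

  isZero? : ∀ {r} (u : Vec ℕ r) → Dec (u ≡ zeros)
  isZero? u = ≡-dec _≟_ u zeros

  sum-zeros : ∀ r → sum (zeros {r}) ≡ 0
  sum-zeros zero    = refl
  sum-zeros (suc r) = sum-zeros r

  factProd-zeros : ∀ r → factProd (zeros {r}) ≡ 1
  factProd-zeros zero    = refl
  factProd-zeros (suc r) = trans (+-identityʳ _) (factProd-zeros r)

  sum≤0⇒zeros : ∀ {r} (u : Vec ℕ r) → sum u ≤ 0 → u ≡ zeros
  sum≤0⇒zeros []         _     = refl
  sum≤0⇒zeros (zero ∷ u) |u|≤0 = cong (0 ∷_) (sum≤0⇒zeros u |u|≤0)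

  lookup≤sum : ∀ {r} (u : Vec ℕ r) i → lookup u i ≤ sum u
  lookup≤sum (x ∷ u) Fin.zero    = m≤m+n x (sum u)
  lookup≤sum (x ∷ u) (Fin.suc i) = ≤-trans (lookup≤sum u i) (m≤n+m (sum u) x)

  sum-incr : ∀ {r} (u : Vec ℕ r) i → sum (u [ i ]%= suc) ≡ suc (sum u)
  sum-incr (x ∷ u) Fin.zero    = refl
  sum-incr (x ∷ u) (Fin.suc i) = trans (cong (x +_) (sum-incr u i)) (+-suc x (sum u))

  factProd-incr : ∀ {r} (u : Vec ℕ r) i → factProd (u [ i ]%= suc) ≡ suc (lookup u i) * factProd u
  factProd-incr (x ∷ u) Fin.zero    = *-assoc (suc x) (x !) (factProd u)
  factProd-incr (x ∷ u) (Fin.suc i) = trans (cong (x ! *_) (factProd-incr u i)) (*-swap (x !) (suc (lookup u i)) (factProd u))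

  monomial : ∀ {r} → (Fin r → ℕ) → Vec ℕ r → ℕ
  monomial a []      = 1
  monomial a (x ∷ u) = a Fin.zero ^ x * monomial (a ∘ Fin.suc) u

  monomial-zeros : ∀ {r} (a : Fin r → ℕ) → monomial a zeros ≡ 1
  monomial-zeros {zero}  a = refl
  monomial-zeros {suc r} a = trans (+-identityʳ _) (monomial-zeros (a ∘ Fin.suc))

  monomial-incr : ∀ {r} (a : Fin r → ℕ) (u : Vec ℕ r) i → monomial a (u [ i ]%= suc) ≡ a i * monomial a u
  monomial-incr a (x ∷ u) Fin.zero    = *-assoc (a Fin.zero) (a Fin.zero ^ x) (monomial (a ∘ Fin.suc) u)
  monomial-incr a (x ∷ u) (Fin.suc i) =
    trans (cong (a Fin.zero ^ x *_) (monomial-incr (a ∘ Fin.suc) u i))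
          (*-swap (a Fin.zero ^ x) (a (Fin.suc i)) (monomial (a ∘ Fin.suc) u))

  Decrement : ∀ {r} → Vec ℕ r → Fin r × Vec ℕ r → Set
  Decrement u (i , u′) = u ≡ u′ [ i ]%= suc

  -- decrements u lists the decrements (i , u′) of u, one for each colour i used in u
  decrementHead : ∀ {r} → ℕ → Vec ℕ r → List (Fin (suc r) × Vec ℕ (suc r))
  decrementHead zero    u = []
  decrementHead (suc a) u = (Fin.zero , a ∷ u) ∷ []

  keepHead : ∀ {r} → ℕ → Fin r × Vec ℕ r → Fin (suc r) × Vec ℕ (suc r)
  keepHead a (i , u′) = (Fin.suc i , a ∷ u′)

  decrements : ∀ {r} → Vec ℕ r → List (Fin r × Vec ℕ r)
  decrements []      = []
  decrements (a ∷ u) = decrementHead a u ++ map (keepHead a) (decrements u)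

  decrements-sound : ∀ {r} (u : Vec ℕ r) → All (Decrement u) (decrements u)
  decrements-sound []      = []
  decrements-sound (a ∷ u) = All.++⁺ (head a) (All.map⁺ (All.map (cong (a ∷_)) (decrements-sound u)))
    where
    head : ∀ a → All (Decrement (a ∷ u)) (decrementHead a u)
    head zero    = []
    head (suc a) = refl ∷ []

  ∑-decrements-∷ : ∀ {r} a (u : Vec ℕ r) (g : Fin (suc r) × Vec ℕ (suc r) → ℕ) →
    ∑ (decrements (a ∷ u)) g ≡ ∑ (decrementHead a u) g + ∑ (decrements u) (g ∘ keepHead a)
  ∑-decrements-∷ a u g = trans (∑-++ (decrementHead a u) _ g) (cong (∑ (decrementHead a u) g +_) (∑-map (keepHead a) (decrements u) g))

  ∑-decrements-lookup : ∀ {r} (u : Vec ℕ r) → ∑ (decrements u) (λ (i , _) → lookup u i) ≡ sum u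
  ∑-decrements-lookup []      = refl
  ∑-decrements-lookup (a ∷ u) = trans (∑-decrements-∷ a u _) (cong₂ _+_ (head a) (∑-decrements-lookup u))
    where
    head : ∀ a → ∑ (decrementHead a u) (λ (i , _) → lookup (a ∷ u) i) ≡ a
    head zero    = refl
    head (suc a) = +-identityʳ (suc a)

  -- Pascal's rule for (v choose u) = ∏ᵢ (vᵢ choose uᵢ): a new element of colour j in v is
  -- either not chosen, or chosen as one of the uⱼ elements of colour j.
  vecChoose-incr : ∀ {r} (v u : Vec ℕ r) (j : Fin r) →
    vecChoose (v [ j ]%= suc) u ≡ vecChoose v u + ∑ (decrements u) (λ (i , u′) → 𝟙 (j ≟ᶠ i) * vecChoose v u′)
  vecChoose-incr (x ∷ v) (y ∷ u) Fin.zero = begin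
    (suc x C y) * V
      ≡⟨ pascal y ⟩
    (x C y) * V + (∑ (decrementHead y u) g + 0)
      ≡⟨ cong (λ t → (x C y) * V + (∑ (decrementHead y u) g + t)) (sym (∑-0 (decrements u))) ⟩
    (x C y) * V + (∑ (decrementHead y u) g + ∑ (decrements u) (g ∘ keepHead y))
      ≡⟨ cong ((x C y) * V +_) (sym (∑-decrements-∷ y u g)) ⟩
    (x C y) * V + ∑ (decrements (y ∷ u)) g ∎
    where
    V : ℕ
    V = vecChoose v u
    g : Fin _ × Vec ℕ _ → ℕ
    g (i , u′) = 𝟙 (Fin.zero ≟ᶠ i) * vecChoose (x ∷ v) u′
    pascal : ∀ y → (suc x C y) * V ≡ (x C y) * V + (∑ (decrementHead y u) g + 0)
    pascal zero    = sym (+-identityʳ _)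
    pascal (suc a) = begin
      (suc x C suc a) * V                         ≡⟨ cong (_* V) (sym (nCk+nC[k+1]≡[n+1]C[k+1] x a)) ⟩
      ((x C a) + (x C suc a)) * V                 ≡⟨ rearrange (x C a) (x C suc a) V ⟩
      (x C suc a) * V + ((1 * ((x C a) * V) + 0) + 0) ∎
      where
      rearrange : ∀ a b v → (a + b) * v ≡ b * v + ((1 * (a * v) + 0) + 0)
      rearrange = solve-∀
  vecChoose-incr (x ∷ v) (y ∷ u) (Fin.suc j) = begin
    (x C y) * vecChoose (v [ j ]%= suc) u
      ≡⟨ cong ((x C y) *_) (vecChoose-incr v u j) ⟩
    (x C y) * (V + ∑ (decrements u) h)
      ≡⟨ *-distribˡ-+ (x C y) V _ ⟩
    (x C y) * V + (x C y) * ∑ (decrements u) h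
      ≡⟨ cong ((x C y) * V +_) (sym (∑-*ˡ (x C y) (decrements u) h)) ⟩
    (x C y) * V + ∑ (decrements u) (λ p → (x C y) * h p)
      ≡⟨ cong ((x C y) * V +_) (∑-cong (decrements u) (λ (i , u′) → *-swap (x C y) (𝟙 (j ≟ᶠ i)) (vecChoose v u′))) ⟩
    (x C y) * V + (0 + ∑ (decrements u) (g ∘ keepHead y))
      ≡⟨ cong (λ t → (x C y) * V + (t + ∑ (decrements u) (g ∘ keepHead y))) (sym (no-head y)) ⟩
    (x C y) * V + (∑ (decrementHead y u) g + ∑ (decrements u) (g ∘ keepHead y))
      ≡⟨ cong ((x C y) * V +_) (sym (∑-decrements-∷ y u g)) ⟩
    (x C y) * V + ∑ (decrements (y ∷ u)) g ∎
    where
    V : ℕ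
    V = vecChoose v u
    h : Fin _ × Vec ℕ _ → ℕ
    h (i , u′) = 𝟙 (j ≟ᶠ i) * vecChoose v u′
    g : Fin _ × Vec ℕ _ → ℕ
    g (i , u′) = 𝟙 (Fin.suc j ≟ᶠ i) * vecChoose (x ∷ v) u′
    -- colour suc j differs from the first colour
    no-head : ∀ y → ∑ (decrementHead y u) g ≡ 0
    no-head zero    = refl
    no-head (suc a) = refl

  vecChoose-zeros : ∀ {r} (u : Vec ℕ r) → vecChoose zeros u ≡ 𝟙 (isZero? u)
  vecChoose-zeros []      = refl
  vecChoose-zeros (x ∷ u) = trans (cong₂ _*_ (0-choose x) (vecChoose-zeros u)) (sym (𝟙-×-dec (x ≟ 0) (isZero? u)))
    where
    0-choose : ∀ x → 0 C x ≡ 𝟙 (x ≟ 0)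
    0-choose zero    = refl
    0-choose (suc x) = refl

  tabulate-incr : ∀ {r} (j : Fin r) (f : Fin r → ℕ) → tabulate (λ i → 𝟙 (j ≟ᶠ i) + f i) ≡ tabulate f [ j ]%= suc
  tabulate-incr Fin.zero    f = refl
  tabulate-incr (Fin.suc j) f = cong (f Fin.zero ∷_) (tabulate-incr j (f ∘ Fin.suc))

  boxVecs-once : ∀ {r} b (p : Vec ℕ r) → (∀ i → lookup p i ≤ b) → ∑ (boxVecs r b) (λ v → 𝟙 (≡-dec _≟_ p v)) ≡ 1
  boxVecs-once b []       _   = refl
  boxVecs-once {suc r} b (p₀ ∷ p) p≤b = begin
    ∑ (concatMap (λ x → map (x ∷_) B) U) f                 ≡⟨ ∑-concatMap (λ x → map (x ∷_) B) U f ⟩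
    ∑ U (λ x → ∑ (map (x ∷_) B) f)                        ≡⟨ ∑-cong U (λ x → ∑-map (x ∷_) B f) ⟩
    ∑ U (λ x → ∑ B (λ v → 𝟙 (p₀ ≟ x ×-dec ≡-dec _≟_ p v))) ≡⟨ ∑-cong U (λ x → ∑-cong B (λ v → 𝟙-×-dec (p₀ ≟ x) (≡-dec _≟_ p v))) ⟩
    ∑ U (λ x → ∑ B (λ v → 𝟙 (p₀ ≟ x) * 𝟙 (≡-dec _≟_ p v))) ≡⟨ ∑-cong U (λ x → ∑-*ˡ (𝟙 (p₀ ≟ x)) B _) ⟩
    ∑ U (λ x → 𝟙 (p₀ ≟ x) * ∑ B (λ v → 𝟙 (≡-dec _≟_ p v))) ≡⟨ ∑-cong U (λ x → cong (𝟙 (p₀ ≟ x) *_) (boxVecs-once b p (p≤b ∘ Fin.suc))) ⟩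
    ∑ U (λ x → 𝟙 (p₀ ≟ x) * 1)                            ≡⟨ ∑-pick _≟_ (upTo⁺ (suc b)) (∈-upTo⁺ (s≤s (p≤b Fin.zero))) (λ _ → 1) ⟩
    1                                                     ∎
    where
    B : List (Vec ℕ r)
    B = boxVecs r b
    U : List ℕ
    U = upTo (suc b)
    f : Vec ℕ (suc r) → ℕ
    f v = 𝟙 (≡-dec _≟_ (p₀ ∷ p) v)

  compositions-once : ∀ {r} d (p : Vec ℕ r) → sum p ≡ d → ∑ (compositions r d) (λ v → 𝟙 (≡-dec _≟_ p v)) ≡ 1
  compositions-once {r} d p |p|≡d = begin
    ∑ (compositions r d) (λ v → 𝟙 (≡-dec _≟_ p v))                  ≡⟨ ∑-filter (λ v → sum v ≟ d) (boxVecs r d) _ ⟩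
    ∑ (boxVecs r d) (λ v → 𝟙 (sum v ≟ d) * 𝟙 (≡-dec _≟_ p v))       ≡⟨ ∑-cong (boxVecs r d) drop-sum-test ⟩
    ∑ (boxVecs r d) (λ v → 𝟙 (≡-dec _≟_ p v))                       ≡⟨ boxVecs-once d p (λ i → ≤-trans (lookup≤sum p i) (≤-reflexive |p|≡d)) ⟩
    1                                                               ∎
    where
    drop-sum-test : ∀ v → 𝟙 (sum v ≟ d) * 𝟙 (≡-dec _≟_ p v) ≡ 𝟙 (≡-dec _≟_ p v)
    drop-sum-test v with ≡-dec _≟_ p v
    ... | yes refl = cong (_* 1) (𝟙-yes (sum p ≟ d) |p|≡d)
    ... | no  _    = *-zeroʳ (𝟙 (sum v ≟ d))

  -- A constraint on one coordinate of a point of X^d, where X = Fin n is coloured by Fin r: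
  -- none, "is the point p", or "has colour i".
  data Constraint (n r : ℕ) : Set where
    free   : Constraint n r
    point  : Fin n → Constraint n r
    colour : Fin r → Constraint n r

  ∑ᵥ : ∀ {A : Set} {d} → (A → ℕ) → Vec A d → ℕ
  ∑ᵥ φ []      = 0
  ∑ᵥ φ (x ∷ E) = φ x + ∑ᵥ φ E

  ∏ᵥ : ∀ {A : Set} {d} → (A → ℕ) → Vec A d → ℕ
  ∏ᵥ φ []      = 1
  ∏ᵥ φ (x ∷ E) = φ x * ∏ᵥ φ E

  ∑ᵥ-≔ : ∀ {A : Set} {d} (φ : A → ℕ) {b} → φ b ≡ 0 → ∀ (E : Vec A d) j e →
    ∑ᵥ φ (E [ j ]≔ e) ≡ φ e + ∑ᵥ φ (E [ j ]≔ b)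
  ∑ᵥ-≔ φ φb≡0 (x ∷ E) Fin.zero    e = cong (λ t → φ e + (t + ∑ᵥ φ E)) (sym φb≡0)
  ∑ᵥ-≔ φ φb≡0 (x ∷ E) (Fin.suc j) e = trans (cong (φ x +_) (∑ᵥ-≔ φ φb≡0 E j e)) (+-swap (φ x) (φ e) _)

  ∏ᵥ-≔ : ∀ {A : Set} {d} (φ : A → ℕ) {b} → φ b ≡ 1 → ∀ (E : Vec A d) j e →
    ∏ᵥ φ (E [ j ]≔ e) ≡ φ e * ∏ᵥ φ (E [ j ]≔ b)
  ∏ᵥ-≔ φ φb≡1 (x ∷ E) Fin.zero    e = sym (cong (φ e *_) (trans (cong (_* ∏ᵥ φ E) φb≡1) (*-identityˡ (∏ᵥ φ E))))
  ∏ᵥ-≔ φ φb≡1 (x ∷ E) (Fin.suc j) e = trans (cong (φ x *_) (∏ᵥ-≔ φ φb≡1 E j e)) (*-swap (φ x) (φ e) _)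

  isConstrained : ∀ {n r} → Constraint n r → ℕ
  isConstrained free       = 0
  isConstrained (point _)  = 1
  isConstrained (colour _) = 1

  isColour : ∀ {n r} → Constraint n r → ℕ
  isColour free       = 0
  isColour (point _)  = 0
  isColour (colour _) = 1

  #constrained : ∀ {n r d} → Vec (Constraint n r) d → ℕ
  #constrained = ∑ᵥ isConstrained

  #colours : ∀ {n r d} → Vec (Constraint n r) d → ℕ
  #colours = ∑ᵥ isColour

  #constrained≤ : ∀ {n r d} (E : Vec (Constraint n r) d) → #constrained E ≤ d
  #constrained≤ []             = z≤n
  #constrained≤ (free     ∷ E) = m≤n⇒m≤1+n (#constrained≤ E)
  #constrained≤ (point _  ∷ E) = s≤s (#constrained≤ E)
  #constrained≤ (colour _ ∷ E) = s≤s (#constrained≤ E)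

  findFree : ∀ {n r d} (E : Vec (Constraint n r) d) → #constrained E < d → ∃ λ j → E [ j ]≔ free ≡ E
  findFree (free     ∷ E) _           = Fin.zero , refl
  findFree (point p  ∷ E) (s≤s |E|<d) = let j , E≡ = findFree E |E|<d in Fin.suc j , cong (point p ∷_) E≡
  findFree (colour i ∷ E) (s≤s |E|<d) = let j , E≡ = findFree E |E|<d in Fin.suc j , cong (colour i ∷_) E≡

  findColour : ∀ {n r d} (E : Vec (Constraint n r) d) m → #colours E ≡ suc m → ∃₂ λ j i → E [ j ]≔ colour i ≡ E
  findColour (free     ∷ E) m eq = let j , i , E≡ = findColour E m eq in Fin.suc j , i , cong (free ∷_) E≡
  findColour (point p  ∷ E) m eq = let j , i , E≡ = findColour E m eq in Fin.suc j , i , cong (point p ∷_) E≡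
  findColour (colour i ∷ E) m eq = Fin.zero , i , refl

  -- A colour pattern of type u is a constraint vector with entries free or colour i, colour i
  -- occurring exactly u i times.  patterns d u lists those of length d, by their first entry.
  patterns : ∀ {n r} d → Vec ℕ r → List (Vec (Constraint n r) d)
  patterns zero    u = filter (λ _ → isZero? u) ([] ∷ [])
  patterns (suc d) u =
    map (free ∷_) (patterns d u) ++ concatMap (λ (i , u′) → map (colour i ∷_) (patterns d u′)) (decrements u)

  ∑-patterns-zero : ∀ {n r} (u : Vec ℕ r) (g : Vec (Constraint n r) 0 → ℕ) →
    ∑ (patterns 0 u) g ≡ 𝟙 (isZero? u) * g []
  ∑-patterns-zero u g = trans (∑-filter (λ _ → isZero? u) ([] ∷ []) g) (+-identityʳ _)

  ∑-patterns-suc : ∀ {n r} d (u : Vec ℕ r) (g : Vec (Constraint n r) (suc d) → ℕ) →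
    ∑ (patterns (suc d) u) g ≡
    ∑ (patterns d u) (g ∘ (free ∷_)) + ∑ (decrements u) (λ (i , u′) → ∑ (patterns d u′) (g ∘ (colour i ∷_)))
  ∑-patterns-suc d u g = begin
    ∑ (map (free ∷_) (patterns d u) ++ concatMap colourFirst (decrements u)) g
      ≡⟨ ∑-++ (map (free ∷_) (patterns d u)) _ g ⟩
    ∑ (map (free ∷_) (patterns d u)) g + ∑ (concatMap colourFirst (decrements u)) g
      ≡⟨ cong₂ _+_ (∑-map (free ∷_) (patterns d u) g) (∑-concatMap colourFirst (decrements u) g) ⟩
    ∑ (patterns d u) (g ∘ (free ∷_)) + ∑ (decrements u) (λ p → ∑ (colourFirst p) g)
      ≡⟨ cong (∑ (patterns d u) (g ∘ (free ∷_)) +_) (∑-cong (decrements u) (λ (i , u′) → ∑-map (colour i ∷_) (patterns d u′) g)) ⟩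
    ∑ (patterns d u) (g ∘ (free ∷_)) + ∑ (decrements u) (λ (i , u′) → ∑ (patterns d u′) (g ∘ (colour i ∷_))) ∎
    where
    colourFirst : Fin _ × Vec ℕ _ → List (Vec (Constraint _ _) (suc d))
    colourFirst (i , u′) = map (colour i ∷_) (patterns d u′)

  patterns-ind : ∀ {n r} (P : ∀ {d} → Vec (Constraint n r) d → Vec ℕ r → Set) →
    P [] zeros →
    (∀ {d} {D : Vec (Constraint n r) d} {u} → P D u → P (free ∷ D) u) →
    (∀ {d} {D : Vec (Constraint n r) d} {u i} → P D u → P (colour i ∷ D) (u [ i ]%= suc)) →
    ∀ d u → All (λ D → P D u) (patterns d u)
  patterns-ind P base step-free step-colour zero    u = All.map empty (All.all-filter (λ _ → isZero? u) ([] ∷ []))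
    where
    empty : ∀ {D} → u ≡ zeros → P D u
    empty {[]} refl = base
  patterns-ind P base step-free step-colour (suc d) u =
    All.++⁺ (All.map⁺ (All.map step-free (recurse u)))
            (All.concat⁺ (All.map⁺ (All.map colourFirst (decrements-sound u))))
    where
    recurse : ∀ u → All (λ D → P D u) (patterns d u)
    recurse = patterns-ind P base step-free step-colour d
    colourFirst : ∀ {(i , u′) : Fin _ × Vec ℕ _} → u ≡ u′ [ i ]%= suc → All (λ D → P D u) (map (colour i ∷_) (patterns d u′))
    colourFirst {i , u′} refl = All.map⁺ (All.map step-colour (recurse u′))

  patterns-#constrained : ∀ {n r} d (u : Vec ℕ r) → All (λ D → #constrained D ≡ sum u) (patterns {n} d u)
  patterns-#constrained {r = r} = patterns-ind (λ D u → #constrained D ≡ sum u) (sym (sum-zeros r)) (λ eq → eq)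
    (λ {_} {_} {u} {i} eq → trans (cong suc eq) (sym (sum-incr u i)))

  #patterns : ∀ {n r} → ℕ → Vec ℕ r → ℕ
  #patterns {n} d u = ∑ (patterns {n} d u) (λ _ → 1)

  #patterns-big : ∀ {n r} d (u : Vec ℕ r) → d < sum u → #patterns {n} d u ≡ 0
  #patterns-big {n} d u d<|u| = none (patterns d u) (patterns-#constrained d u)
    where
    none : ∀ (Ds : List (Vec (Constraint n _) d)) → All (λ D → #constrained D ≡ sum u) Ds → ∑ Ds (λ _ → 1) ≡ 0
    none []       []       = refl
    none (D ∷ Ds) (eq ∷ _) = contradiction (≤-trans d<|u| (≤-trans (≤-reflexive (sym eq)) (#constrained≤ D))) (n≮n d)

  multinomial : ∀ {n r} d (u : Vec ℕ r) → sum u ≤ d → #patterns {n} d u * (factProd u * (d ∸ sum u) !) ≡ d !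
  multinomial {n} {r} zero u |u|≤0 = begin
    #patterns {n} 0 u * (factProd u * (0 ∸ sum u) !)  ≡⟨ cong (_* (factProd u * (0 ∸ sum u) !)) (∑-patterns-zero u (λ _ → 1)) ⟩
    𝟙 (isZero? u) * 1 * (factProd u * (0 ∸ sum u) !)   ≡⟨ cong₂ (λ a b → a * 1 * (b * (0 ∸ sum u) !)) (𝟙-yes (isZero? u) u≡0) factProd-u ⟩
    1 * 1 * (1 * (0 ∸ sum u) !)                       ≡⟨ cong (λ m → 1 * 1 * (1 * m !)) (0∸n≡0 (sum u)) ⟩
    1                                                 ∎
    where
    u≡0 : u ≡ zeros
    u≡0 = sum≤0⇒zeros u |u|≤0
    factProd-u : factProd u ≡ 1
    factProd-u = trans (cong factProd u≡0) (factProd-zeros r)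
  multinomial {n} (suc d) u |u|≤1+d = begin
    #patterns {n} (suc d) u * X                            ≡⟨ cong (_* X) (∑-patterns-suc d u (λ _ → 1)) ⟩
    (#patterns {n} d u + ∑ (decrements u) count) * X       ≡⟨ *-distribʳ-+ X (#patterns {n} d u) _ ⟩
    #patterns {n} d u * X + ∑ (decrements u) count * X     ≡⟨ cong₂ _+_ free-first colour-first ⟩
    (suc d ∸ sum u) * d ! + sum u * d !                    ≡⟨ sym (*-distribʳ-+ (d !) (suc d ∸ sum u) (sum u)) ⟩
    (suc d ∸ sum u + sum u) * d !                          ≡⟨ cong (_* d !) (m∸n+n≡m |u|≤1+d) ⟩
    suc d * d !                                            ∎
    where
    X : ℕ
    X = factProd u * (suc d ∸ sum u) !
    count : Fin _ × Vec ℕ _ → ℕ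
    count (_ , u′) = #patterns {n} d u′
    free-first : #patterns {n} d u * X ≡ (suc d ∸ sum u) * d !
    free-first with sum u ≤? d
    ... | yes |u|≤d = begin
      #patterns {n} d u * (factProd u * (suc d ∸ sum u) !)
        ≡⟨ cong (λ m → #patterns {n} d u * (factProd u * m !)) (+-∸-assoc 1 |u|≤d) ⟩
      #patterns {n} d u * (factProd u * (suc (d ∸ sum u) * (d ∸ sum u) !))
        ≡⟨ rearrange (#patterns {n} d u) (factProd u) (suc (d ∸ sum u)) ((d ∸ sum u) !) ⟩
      suc (d ∸ sum u) * (#patterns {n} d u * (factProd u * (d ∸ sum u) !))
        ≡⟨ cong (suc (d ∸ sum u) *_) (multinomial d u |u|≤d) ⟩
      suc (d ∸ sum u) * d !
        ≡⟨ cong (_* d !) (sym (+-∸-assoc 1 |u|≤d)) ⟩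
      (suc d ∸ sum u) * d ! ∎
      where
      rearrange : ∀ a b c e → a * (b * (c * e)) ≡ c * (a * (b * e))
      rearrange = solve-∀
    ... | no |u|≰d = begin
      #patterns {n} d u * X   ≡⟨ cong (_* X) (#patterns-big d u (≰⇒> |u|≰d)) ⟩
      0                       ≡⟨ cong (_* d !) (sym (m≤n⇒m∸n≡0 (≰⇒> |u|≰d))) ⟩
      (suc d ∸ sum u) * d !   ∎
    colour-first-at : ∀ {(i , u′) : Fin _ × Vec ℕ _} → Decrement u (i , u′) → count (i , u′) * X ≡ lookup u i * d !
    colour-first-at {i , u′} refl = begin
      #patterns {n} d u′ * (factProd (u′ [ i ]%= suc) * (suc d ∸ sum (u′ [ i ]%= suc)) !)
        ≡⟨ cong₂ (λ a b → #patterns {n} d u′ * (a * (suc d ∸ b) !)) (factProd-incr u′ i) (sum-incr u′ i) ⟩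
      #patterns {n} d u′ * (suc (lookup u′ i) * factProd u′ * (d ∸ sum u′) !)
        ≡⟨ rearrange (#patterns {n} d u′) (suc (lookup u′ i)) (factProd u′) ((d ∸ sum u′) !) ⟩
      suc (lookup u′ i) * (#patterns {n} d u′ * (factProd u′ * (d ∸ sum u′) !))
        ≡⟨ cong₂ _*_ (sym (lookup∘updateAt i u′)) (multinomial d u′ (≤-pred (subst (_≤ suc d) (sum-incr u′ i) |u|≤1+d))) ⟩
      lookup (u′ [ i ]%= suc) i * d ! ∎
      where
      rearrange : ∀ a b c e → a * (b * c * e) ≡ b * (a * (c * e))
      rearrange = solve-∀
    colour-first : ∑ (decrements u) count * X ≡ sum u * d !
    colour-first = begin
      ∑ (decrements u) count * X                      ≡⟨ sym (∑-*ʳ X (decrements u) count) ⟩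
      ∑ (decrements u) (λ p → count p * X)            ≡⟨ ∑-congᴬ (All.map colour-first-at (decrements-sound u)) ⟩
      ∑ (decrements u) (λ (i , _) → lookup u i * d !) ≡⟨ ∑-*ʳ (d !) (decrements u) _ ⟩
      ∑ (decrements u) (λ (i , _) → lookup u i) * d ! ≡⟨ cong (_* d !) (∑-decrements-lookup u) ⟩
      sum u * d !                                     ∎

  module Colouring {n r : ℕ} (c : Fin n → Fin r) where

    holds : Constraint n r → Fin n → ℕ
    holds free       x = 1
    holds (point p)  x = 𝟙 (x ≟ᶠ p)
    holds (colour i) x = 𝟙 (c x ≟ᶠ i)

    matches : ∀ {d} → Vec (Constraint n r) d → Vec (Fin n) d → ℕ
    matches []      []      = 1
    matches (e ∷ E) (x ∷ y) = holds e x * matches E y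

    matches-≔ : ∀ {d} (E : Vec (Constraint n r) d) j e y →
      matches (E [ j ]≔ e) y ≡ holds e (lookup y j) * matches (E [ j ]≔ free) y
    matches-≔ (e′ ∷ E) Fin.zero    e (z ∷ y) = cong (holds e z *_) (sym (+-identityʳ (matches E y)))
    matches-≔ (e′ ∷ E) (Fin.suc j) e (z ∷ y) =
      trans (cong (holds e′ z *_) (matches-≔ E j e y)) (*-swap (holds e′ z) (holds e (lookup y j)) _)

    size-free : ∑ (allFin n) (holds free) ≡ n
    size-free = trans (∑-const (allFin n) 1) (trans (*-identityʳ _) (List.length-tabulate (λ x → x)))

    size-colour : ∀ i → ∑ (allFin n) (holds (colour i)) ≡ classSize c i
    size-colour i = sym (length-filter (λ x → c x ≟ᶠ i) (allFin n))

    weightOf : Constraint n r → ℕ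
    weightOf free       = 1
    weightOf (point _)  = 1
    weightOf (colour i) = classSize c i

    weight : ∀ {d} → Vec (Constraint n r) d → ℕ
    weight = ∏ᵥ weightOf

    weight-no-colours : ∀ {d} (E : Vec (Constraint n r) d) → #colours E ≡ 0 → weight E ≡ 1
    weight-no-colours []            _         = refl
    weight-no-colours (free ∷ E)    no-colour = trans (+-identityʳ _) (weight-no-colours E no-colour)
    weight-no-colours (point _ ∷ E) no-colour = trans (+-identityʳ _) (weight-no-colours E no-colour)

    patterns-weight : ∀ d u → All (λ D → weight D ≡ monomial (classSize c) u) (patterns d u)
    patterns-weight = patterns-ind (λ D u → weight D ≡ monomial (classSize c) u) (sym (monomial-zeros (classSize c)))
      (λ eq → trans (+-identityʳ _) eq)
      (λ {_} {_} {u} {i} eq → trans (cong (classSize c i *_) eq) (sym (monomial-incr (classSize c) u i)))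

    record PointConstraints {d} (E : Vec (Constraint n r) d) : Set where
      field
        ι        : Fin (#constrained E) → Fin d
        ι-incr   : StrictlyIncreasing ι
        a        : Vec (Fin n) (#constrained E)
        matches≡ : ∀ y → matches E y ≡ 𝟙 (≡-dec _≟ᶠ_ (restrict ι y) a)

    pointConstraints : ∀ {d} (E : Vec (Constraint n r) d) → #colours E ≡ 0 → PointConstraints E
    pointConstraints []             _         = record { ι = λ () ; ι-incr = λ () ; a = [] ; matches≡ = λ { [] → refl } }
    pointConstraints (free ∷ E)     no-colour = record
      { ι        = Fin.suc ∘ P.ι
      ; ι-incr   = λ i j i<j → s≤s (P.ι-incr i j i<j)
      ; a        = P.a
      ; matches≡ = λ { (z ∷ y) → trans (+-identityʳ (matches E y)) (P.matches≡ y) }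
      }
      where module P = PointConstraints (pointConstraints E no-colour)
    pointConstraints (point p ∷ E)  no-colour = record
      { ι        = Fin.zero ∷ᶠ (Fin.suc ∘ P.ι)
      ; ι-incr   = ι-incr
      ; a        = p ∷ P.a
      ; matches≡ = λ { (z ∷ y) → trans (cong (𝟙 (z ≟ᶠ p) *_) (P.matches≡ y)) (sym (𝟙-×-dec (z ≟ᶠ p) (≡-dec _≟ᶠ_ (restrict P.ι y) P.a))) }
      }
      where
      module P = PointConstraints (pointConstraints E no-colour)
      ι-incr : StrictlyIncreasing (Fin.zero ∷ᶠ (Fin.suc ∘ P.ι))
      ι-incr Fin.zero    (Fin.suc j) _         = s≤s z≤n
      ι-incr (Fin.suc i) (Fin.suc j) (s≤s i<j) = s≤s (P.ι-incr i j i<j)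
    pointConstraints (colour _ ∷ E) ()

    profile-[] : profile c [] ≡ zeros
    profile-[] = zeros≡tabulate r
      where
      zeros≡tabulate : ∀ r → tabulate {n = r} (λ _ → 0) ≡ zeros
      zeros≡tabulate zero    = refl
      zeros≡tabulate (suc r) = cong (0 ∷_) (zeros≡tabulate r)

    profile-∷ : ∀ {d} z (y : Vec (Fin n) d) → profile c (z ∷ y) ≡ profile c y [ c z ]%= suc
    profile-∷ z y = trans (tabulate-cong count-∷) (tabulate-incr (c z) _)
      where
      count-∷ : ∀ i → length (filter (λ x → c x ≟ᶠ i) (z ∷ toList y)) ≡ 𝟙 (c z ≟ᶠ i) + length (filter (λ x → c x ≟ᶠ i) (toList y))
      count-∷ i = trans (length-filter (λ x → c x ≟ᶠ i) (z ∷ toList y)) (cong (_ +_) (sym (length-filter (λ x → c x ≟ᶠ i) (toList y))))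

    sum-profile : ∀ {d} (y : Vec (Fin n) d) → sum (profile c y) ≡ d
    sum-profile []      = trans (cong sum profile-[]) (sum-zeros r)
    sum-profile (z ∷ y) = trans (cong sum (profile-∷ z y)) (trans (sum-incr (profile c y) (c z)) (cong suc (sum-profile y)))

    ∑-compositions : ∀ {d} (S : List (Vec (Fin n) d)) u →
      ∑ (compositions r d) (λ v → vecChoose v u * s c S v) ≡ ∑ S (λ y → vecChoose (profile c y) u)
    ∑-compositions {d} S u = ∑-group (≡-dec _≟_) (profile c) (compositions r d) (λ v → vecChoose v u) S
      (λ y → compositions-once d (profile c y) (sum-profile y))

    -- (profile y choose u) is the number of patterns of type u matched by y: for each colour i,
    -- choosing uᵢ of the coordinates of colour i is choosing where the pattern puts colour i.
    vecChoose-profile : ∀ {d} (y : Vec (Fin n) d) u → vecChoose (profile c y) u ≡ ∑ (patterns d u) (λ D → matches D y)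
    vecChoose-profile []      u = begin
      vecChoose (profile c []) u            ≡⟨ cong (λ v → vecChoose v u) profile-[] ⟩
      vecChoose zeros u                     ≡⟨ vecChoose-zeros u ⟩
      𝟙 (isZero? u)                         ≡⟨ sym (*-identityʳ _) ⟩
      𝟙 (isZero? u) * 1                     ≡⟨ sym (∑-patterns-zero u (λ D → matches D [])) ⟩
      ∑ (patterns 0 u) (λ D → matches D []) ∎
    vecChoose-profile {suc d} (z ∷ y) u = begin
      vecChoose (profile c (z ∷ y)) u
        ≡⟨ cong (λ v → vecChoose v u) (profile-∷ z y) ⟩
      vecChoose (profile c y [ c z ]%= suc) u
        ≡⟨ vecChoose-incr (profile c y) u (c z) ⟩
      vecChoose (profile c y) u + ∑ (decrements u) (λ (i , u′) → holds (colour i) z * vecChoose (profile c y) u′)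
        ≡⟨ cong₂ _+_ (trans (vecChoose-profile y u) free-first) (∑-cong (decrements u) colour-first) ⟩
      ∑ (patterns d u) (m ∘ (free ∷_)) + ∑ (decrements u) (λ (i , u′) → ∑ (patterns d u′) (m ∘ (colour i ∷_)))
        ≡⟨ sym (∑-patterns-suc d u m) ⟩
      ∑ (patterns (suc d) u) m ∎
      where
      m : Vec (Constraint n r) (suc d) → ℕ
      m D = matches D (z ∷ y)
      free-first : ∑ (patterns d u) (λ D → matches D y) ≡ ∑ (patterns d u) (m ∘ (free ∷_))
      free-first = ∑-cong (patterns d u) (λ D → sym (+-identityʳ _))
      colour-first : ∀ ((i , u′) : Fin r × Vec ℕ r) →
        holds (colour i) z * vecChoose (profile c y) u′ ≡ ∑ (patterns d u′) (m ∘ (colour i ∷_))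
      colour-first (i , u′) =
        trans (cong (holds (colour i) z *_) (vecChoose-profile y u′)) (sym (∑-*ˡ (holds (colour i) z) (patterns d u′) _))

    module OrthogonalArray {d k : ℕ} (S : List (Vec (Fin n) d)) (oa : IsOA n d k S) (k≤d : k ≤ d) where

      count : Vec (Constraint n r) d → ℕ
      count E = ∑ S (matches E)

      -- the constraint e on coordinate j is the disjoint union of the point constraints it allows
      expand : ∀ E j e → count (E [ j ]≔ e) ≡ ∑ (allFin n) (λ x → holds e x * count (E [ j ]≔ point x))
      expand E j e = sym (begin
        ∑ (allFin n) (λ x → holds e x * ∑ S (matches (E [ j ]≔ point x)))
          ≡⟨ ∑-cong (allFin n) (λ x → sym (∑-*ˡ (holds e x) S _)) ⟩
        ∑ (allFin n) (λ x → ∑ S (λ y → holds e x * matches (E [ j ]≔ point x) y))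
          ≡⟨ ∑-swap (allFin n) S _ ⟩
        ∑ S (λ y → ∑ (allFin n) (λ x → holds e x * matches (E [ j ]≔ point x) y))
          ≡⟨ ∑-cong S (λ y → ∑-cong (allFin n) (at-point y)) ⟩
        ∑ S (λ y → ∑ (allFin n) (λ x → 𝟙 (lookup y j ≟ᶠ x) * (holds e x * matches (E [ j ]≔ free) y)))
          ≡⟨ ∑-cong S (λ y → ∑-pick _≟ᶠ_ (allFin⁺ n) (∈-allFin (lookup y j)) _) ⟩
        ∑ S (λ y → holds e (lookup y j) * matches (E [ j ]≔ free) y)
          ≡⟨ ∑-cong S (λ y → sym (matches-≔ E j e y)) ⟩
        count (E [ j ]≔ e) ∎)
        where
        at-point : ∀ y x → holds e x * matches (E [ j ]≔ point x) y ≡ 𝟙 (lookup y j ≟ᶠ x) * (holds e x * matches (E [ j ]≔ free) y)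
        at-point y x = trans (cong (holds e x *_) (matches-≔ E j (point x) y)) (*-swap (holds e x) (𝟙 (lookup y j ≟ᶠ x)) _)

      expand-uniform : ∀ E j e N → (∀ x → count (E [ j ]≔ point x) ≡ N) → count (E [ j ]≔ e) ≡ ∑ (allFin n) (holds e) * N
      expand-uniform E j e N uniform = begin
        count (E [ j ]≔ e)                                         ≡⟨ expand E j e ⟩
        ∑ (allFin n) (λ x → holds e x * count (E [ j ]≔ point x)) ≡⟨ ∑-cong (allFin n) (λ x → cong (holds e x *_) (uniform x)) ⟩
        ∑ (allFin n) (λ x → holds e x * N)                         ≡⟨ ∑-*ʳ N (allFin n) (holds e) ⟩
        ∑ (allFin n) (holds e) * N                                 ∎

      -- Induction on t
      -- frees one more coordinate; for t = 0 this is the orthogonal array property.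
      count-points : ∀ t E → #colours E ≡ 0 → #constrained E + t ≡ k → count E ≡ n ^ t
      count-points zero    E no-colour |E|+0≡k = begin
        ∑ S (matches E)                                           ≡⟨ ∑-cong S P.matches≡ ⟩
        ∑ S (λ y → 𝟙 (≡-dec _≟ᶠ_ (restrict P.ι y) P.a))          ≡⟨ sym (length-filter (λ y → ≡-dec _≟ᶠ_ (restrict P.ι y) P.a) S) ⟩
        length (filter (λ y → ≡-dec _≟ᶠ_ (restrict P.ι y) P.a) S) ≡⟨ oa′ P.ι P.ι-incr P.a ⟩
        1                                                         ∎
        where
        module P = PointConstraints (pointConstraints E no-colour)
        oa′ : IsOA n d (#constrained E) S
        oa′ = subst (λ k′ → IsOA n d k′ S) (sym (trans (sym (+-identityʳ _)) |E|+0≡k)) oa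
      count-points (suc t) E no-colour |E|+1+t≡k = begin
        count E                           ≡⟨ cong count (sym E[j]≔free≡E) ⟩
        count (E [ j ]≔ free)             ≡⟨ expand-uniform E j free (n ^ t) fill ⟩
        ∑ (allFin n) (holds free) * n ^ t ≡⟨ cong (_* n ^ t) size-free ⟩
        n * n ^ t                         ∎
        where
        |E|<d : #constrained E < d
        |E|<d = ≤-trans (m<m+n (#constrained E) (s≤s z≤n)) (≤-trans (≤-reflexive |E|+1+t≡k) k≤d)
        j : Fin d
        j = proj₁ (findFree E |E|<d)
        E[j]≔free≡E : E [ j ]≔ free ≡ E
        E[j]≔free≡E = proj₂ (findFree E |E|<d)
        fill : ∀ x → count (E [ j ]≔ point x) ≡ n ^ t
        fill x = count-points t (E [ j ]≔ point x)
          (trans (∑ᵥ-≔ isColour refl E j (point x)) (trans (cong #colours E[j]≔free≡E) no-colour))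
          (trans (cong (_+ t) (trans (∑ᵥ-≔ isConstrained refl E j (point x)) (cong (suc ∘ #constrained) E[j]≔free≡E)))
                 (trans (sym (+-suc (#constrained E) t)) |E|+1+t≡k))

      -- With at most k constraints, n^(k - #constrained E) · weight E points of S match E:
      -- induction on the number of colour constraints, replacing one by the points of its class.
      count-constraints : ∀ m E → #colours E ≡ m → #constrained E ≤ k → count E ≡ n ^ (k ∸ #constrained E) * weight E
      count-constraints zero    E no-colour |E|≤k = begin
        count E                              ≡⟨ count-points (k ∸ #constrained E) E no-colour (m+[n∸m]≡n |E|≤k) ⟩
        n ^ (k ∸ #constrained E)             ≡⟨ sym (*-identityʳ _) ⟩
        n ^ (k ∸ #constrained E) * 1         ≡⟨ cong (n ^ (k ∸ #constrained E) *_) (sym (weight-no-colours E no-colour)) ⟩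
        n ^ (k ∸ #constrained E) * weight E  ∎
      count-constraints (suc m) E #colours≡1+m |E|≤k = begin
        count E                                      ≡⟨ cong count (sym E[j]≔colour≡E) ⟩
        count (E [ j ]≔ colour i)                    ≡⟨ expand-uniform E j (colour i) (N * weight E₀) fill ⟩
        ∑ (allFin n) (holds (colour i)) * (N * weight E₀) ≡⟨ cong (_* (N * weight E₀)) (size-colour i) ⟩
        classSize c i * (N * weight E₀)              ≡⟨ *-swap (classSize c i) N (weight E₀) ⟩
        N * (classSize c i * weight E₀)              ≡⟨ cong (N *_) (sym weight-E) ⟩
        N * weight E                                 ∎
        where
        j : Fin d
        j = proj₁ (findColour E m #colours≡1+m)
        i : Fin r
        i = proj₁ (proj₂ (findColour E m #colours≡1+m))
        E[j]≔colour≡E : E [ j ]≔ colour i ≡ E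
        E[j]≔colour≡E = proj₂ (proj₂ (findColour E m #colours≡1+m))
        E₀ : Vec (Constraint n r) d
        E₀ = E [ j ]≔ free
        N : ℕ
        N = n ^ (k ∸ #constrained E)
        |E[j]≔point| : ∀ x → #constrained (E [ j ]≔ point x) ≡ #constrained E
        |E[j]≔point| x = trans (∑ᵥ-≔ isConstrained refl E j (point x))
          (sym (trans (cong #constrained (sym E[j]≔colour≡E)) (∑ᵥ-≔ isConstrained refl E j (colour i))))
        #colours-E₀ : #colours E₀ ≡ m
        #colours-E₀ = suc-injective (trans (sym (∑ᵥ-≔ isColour refl E j (colour i))) (trans (cong #colours E[j]≔colour≡E) #colours≡1+m))
        weight-E : weight E ≡ classSize c i * weight E₀
        weight-E = trans (cong weight (sym E[j]≔colour≡E)) (∏ᵥ-≔ weightOf refl E j (colour i))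
        fill : ∀ x → count (E [ j ]≔ point x) ≡ N * weight E₀
        fill x = begin
          count (E [ j ]≔ point x)
            ≡⟨ count-constraints m (E [ j ]≔ point x) (trans (∑ᵥ-≔ isColour refl E j (point x)) #colours-E₀)
                 (≤-trans (≤-reflexive (|E[j]≔point| x)) |E|≤k) ⟩
          n ^ (k ∸ #constrained (E [ j ]≔ point x)) * weight (E [ j ]≔ point x)
            ≡⟨ cong₂ (λ a b → n ^ (k ∸ a) * b) (|E[j]≔point| x) (trans (∏ᵥ-≔ weightOf refl E j (point x)) (+-identityʳ _)) ⟩
          N * weight E₀ ∎

      -- Double counting the pairs (y ∈ S, pattern D of type u matched by y).
      ∑-vecChoose-profile : ∀ u → sum u ≤ k →
        ∑ S (λ y → vecChoose (profile c y) u) ≡ #patterns {n} d u * (n ^ (k ∸ sum u) * monomial (classSize c) u)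
      ∑-vecChoose-profile u |u|≤k = begin
        ∑ S (λ y → vecChoose (profile c y) u)
          ≡⟨ ∑-cong S (λ y → vecChoose-profile y u) ⟩
        ∑ S (λ y → ∑ (patterns d u) (λ D → matches D y))
          ≡⟨ ∑-swap S (patterns d u) _ ⟩
        ∑ (patterns d u) count
          ≡⟨ ∑-congᴬ (All.zipWith (λ {D} → count-pattern {D}) (patterns-#constrained d u , patterns-weight d u)) ⟩
        ∑ (patterns d u) (λ _ → 1 * K)
          ≡⟨ ∑-*ʳ K (patterns d u) (λ _ → 1) ⟩
        #patterns d u * K ∎
        where
        K : ℕ
        K = n ^ (k ∸ sum u) * monomial (classSize c) u
        count-pattern : ∀ {D} → #constrained D ≡ sum u × weight D ≡ monomial (classSize c) u → count D ≡ 1 * K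
        count-pattern {D} (|D|≡|u| , weight≡) = begin
          count D                             ≡⟨ count-constraints (#colours D) D refl (≤-trans (≤-reflexive |D|≡|u|) |u|≤k) ⟩
          n ^ (k ∸ #constrained D) * weight D ≡⟨ cong₂ (λ a b → n ^ (k ∸ a) * b) |D|≡|u| weight≡ ⟩
          K                                   ≡⟨ sym (*-identityˡ K) ⟩
          1 * K                               ∎

      moment-identity : ∀ u → sum u ≤ k →
        ∑ (compositions r d) (λ v → vecChoose v u * s c S v) * (factProd u * (d ∸ sum u) !) * n ^ sum u
          ≡ d ! * monomial (classSize c) u * n ^ k
      moment-identity u |u|≤k = begin
        ∑ (compositions r d) (λ v → vecChoose v u * s c S v) * G * n ^ sum u
          ≡⟨ cong (λ t → t * G * n ^ sum u) (trans (∑-compositions S u) (∑-vecChoose-profile u |u|≤k)) ⟩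
        #patterns {n} d u * (N * A) * G * n ^ sum u
          ≡⟨ rearrange (#patterns {n} d u) N A G (n ^ sum u) ⟩
        #patterns {n} d u * G * A * (N * n ^ sum u)
          ≡⟨ cong₂ (λ a b → a * A * b) (multinomial d u (≤-trans |u|≤k k≤d)) n^[k∸|u|]*n^|u| ⟩
        d ! * A * n ^ k ∎
        where
        G N A : ℕ
        G = factProd u * (d ∸ sum u) !
        N = n ^ (k ∸ sum u)
        A = monomial (classSize c) u
        rearrange : ∀ P N A G M → P * (N * A) * G * M ≡ P * G * A * (N * M)
        rearrange = solve-∀
        n^[k∸|u|]*n^|u| : N * n ^ sum u ≡ n ^ k
        n^[k∸|u|]*n^|u| = trans (sym (^-distribˡ-+-* n (k ∸ sum u) (sum u))) (cong (n ^_) (m∸n+n≡m |u|≤k))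

open Combinatorics

open import Data.Empty using (⊥-elim)
open import Data.Fin as Fin using (Fin)
open import Data.Integer as ℤ using (+_)
import Data.Integer.Properties as ℤ
open import Data.List as List using (List; []; _∷_; map; allFin)
import Data.List.Properties as List
open import Data.Nat as ℕ using (ℕ; zero; suc; NonZero; _≤_; _^_; _∸_; _!)
open import Data.Nat.Properties using (m^n≢0; m*n≢0; _!≢0; *-identityʳ; ^-distribˡ-+-*)
open import Data.Nat.Tactic.RingSolver using (solve-∀)
open import Data.Rational as ℚ using (ℚ; _/_; _*_; toℚᵘ)
open import Data.Rational.Properties using (toℚᵘ-fromℚᵘ; toℚᵘ-injective; toℚᵘ-homo-+; toℚᵘ-homo-*)
open import Data.Rational.Unnormalised as ℚᵘ using (mkℚᵘ; *≡*)
open import Data.Rational.Unnormalised.Properties as ℚᵘ using (≃-trans; ≃-sym)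
open import Data.Vec as Vec using (Vec; []; _∷_; lookup; sum)
open import Function using (_∘_)
open import Relation.Binary.PropositionalEquality
open ≡-Reasoning

toℚᵘ-frac : ∀ a b → toℚᵘ ((+ a) / suc b) ℚᵘ.≃ mkℚᵘ (+ a) b
toℚᵘ-frac a b = toℚᵘ-fromℚᵘ (mkℚᵘ (+ a) b)

frac-* : ∀ a b c e .{{_ : NonZero b}} .{{_ : NonZero e}} →
  ((+ a) / b) * ((+ c) / e) ≡ _/_ (+ (a ℕ.* c)) (b ℕ.* e) {{m*n≢0 b e}}
frac-* a zero    c e       = ⊥-elim (ℕ.≢-nonZero⁻¹ zero refl)
frac-* a (suc b) c zero    = ⊥-elim (ℕ.≢-nonZero⁻¹ zero refl)
frac-* a (suc b) c (suc e) = toℚᵘ-injective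
  (≃-trans (toℚᵘ-homo-* ((+ a) / suc b) ((+ c) / suc e))
  (≃-trans (ℚᵘ.*-cong (toℚᵘ-frac a b) (toℚᵘ-frac c e))
  (≃-trans (*≡* (cong (ℤ._* + suc (e ℕ.+ b ℕ.* suc e)) (sym (ℤ.pos-* a c))))
           (≃-sym (toℚᵘ-frac (a ℕ.* c) _)))))

frac-+ : ∀ a b c e .{{_ : NonZero b}} .{{_ : NonZero e}} →
  ((+ a) / b) ℚ.+ ((+ c) / e) ≡ _/_ (+ (a ℕ.* e ℕ.+ c ℕ.* b)) (b ℕ.* e) {{m*n≢0 b e}}
frac-+ a zero    c e       = ⊥-elim (ℕ.≢-nonZero⁻¹ zero refl)
frac-+ a (suc b) c zero    = ⊥-elim (ℕ.≢-nonZero⁻¹ zero refl)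
frac-+ a (suc b) c (suc e) = toℚᵘ-injective
  (≃-trans (toℚᵘ-homo-+ ((+ a) / suc b) ((+ c) / suc e))
  (≃-trans (ℚᵘ.+-cong (toℚᵘ-frac a b) (toℚᵘ-frac c e))
  (≃-trans (*≡* (cong (ℤ._* + suc (e ℕ.+ b ℕ.* suc e)) numerator))
           (≃-sym (toℚᵘ-frac (a ℕ.* suc e ℕ.+ c ℕ.* suc b) _)))))
  where
  numerator : + a ℤ.* + suc e ℤ.+ + c ℤ.* + suc b ≡ + (a ℕ.* suc e ℕ.+ c ℕ.* suc b)
  numerator = sym (trans (ℤ.pos-+ (a ℕ.* suc e) (c ℕ.* suc b)) (cong₂ ℤ._+_ (ℤ.pos-* a (suc e)) (ℤ.pos-* c (suc b))))

frac-cong : ∀ a b c e .{{_ : NonZero b}} .{{_ : NonZero e}} → a ℕ.* e ≡ c ℕ.* b → (+ a) / b ≡ (+ c) / e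
frac-cong a zero    c e       _  = ⊥-elim (ℕ.≢-nonZero⁻¹ zero refl)
frac-cong a (suc b) c zero    _  = ⊥-elim (ℕ.≢-nonZero⁻¹ zero refl)
frac-cong a (suc b) c (suc e) eq = toℚᵘ-injective
  (≃-trans (toℚᵘ-frac a b) (≃-trans (*≡* cross) (≃-sym (toℚᵘ-frac c e))))
  where
  cross : + a ℤ.* + suc e ≡ + c ℤ.* + suc b
  cross = trans (sym (ℤ.pos-* a (suc e))) (trans (cong +_ eq) (ℤ.pos-* c (suc b)))

ℕ→ℚ-* : ∀ a b → ℕ→ℚ (a ℕ.* b) ≡ ℕ→ℚ a * ℕ→ℚ b
ℕ→ℚ-* a b = sym (frac-* a 1 b 1)

ℕ→ℚ-+ : ∀ a b → ℕ→ℚ (a ℕ.+ b) ≡ ℕ→ℚ a ℚ.+ ℕ→ℚ b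
ℕ→ℚ-+ a b = sym (trans (frac-+ a 1 b 1) (cong (λ m → (+ m) / 1) (cong₂ ℕ._+_ (*-identityʳ a) (*-identityʳ b))))

sumℚ-ℕ→ℚ : ∀ {A : Set} (f g : A → ℕ) (xs : List A) →
  sumℚ (map (λ x → ℕ→ℚ (f x) * ℕ→ℚ (g x)) xs) ≡ ℕ→ℚ (∑ xs (λ x → f x ℕ.* g x))
sumℚ-ℕ→ℚ f g []       = refl
sumℚ-ℕ→ℚ f g (x ∷ xs) = begin
  ℕ→ℚ (f x) * ℕ→ℚ (g x) ℚ.+ sumℚ (map (λ x → ℕ→ℚ (f x) * ℕ→ℚ (g x)) xs)
    ≡⟨ cong₂ ℚ._+_ (sym (ℕ→ℚ-* (f x) (g x))) (sumℚ-ℕ→ℚ f g xs) ⟩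
  ℕ→ℚ (f x ℕ.* g x) ℚ.+ ℕ→ℚ (∑ xs (λ x → f x ℕ.* g x))
    ≡⟨ sym (ℕ→ℚ-+ (f x ℕ.* g x) _) ⟩
  ℕ→ℚ (f x ℕ.* g x ℕ.+ ∑ xs (λ x → f x ℕ.* g x)) ∎

module _ (n : ℕ) .{{n≢0 : NonZero n}} where

  frac-^ : ∀ x m → ((+ x) / n) ^ℚ m ≡ _/_ (+ (x ^ m)) (n ^ m) {{m^n≢0 n m}}
  frac-^ x zero    = refl
  frac-^ x (suc m) = trans (cong (((+ x) / n) *_) (frac-^ x m)) (frac-* x n (x ^ m) (n ^ m) {{n≢0}} {{m^n≢0 n m}})

  prodℚ-powers : ∀ {r} (a : Fin r → ℕ) (u : Vec ℕ r) →
    prodℚ (map (λ i → ((+ a i) / n) ^ℚ lookup u i) (allFin r)) ≡ _/_ (+ monomial a u) (n ^ sum u) {{m^n≢0 n (sum u)}}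
  prodℚ-powers {zero}  a []      = refl
  prodℚ-powers {suc r} a (x ∷ u) = begin
    F Fin.zero * prodℚ (map F (List.tabulate Fin.suc))
      ≡⟨ cong (λ t → F Fin.zero * prodℚ t) (trans (List.map-tabulate Fin.suc F) (sym (List.map-tabulate (λ i → i) (F ∘ Fin.suc)))) ⟩
    F Fin.zero * prodℚ (map (F ∘ Fin.suc) (allFin r))
      ≡⟨ cong₂ _*_ (frac-^ (a Fin.zero) x) (prodℚ-powers (a ∘ Fin.suc) u) ⟩
    _/_ (+ (a Fin.zero ^ x)) (n ^ x) {{n^x≢0}} * _/_ (+ monomial (a ∘ Fin.suc) u) (n ^ sum u) {{n^|u|≢0}}
      ≡⟨ frac-* (a Fin.zero ^ x) (n ^ x) (monomial (a ∘ Fin.suc) u) (n ^ sum u) {{n^x≢0}} {{n^|u|≢0}} ⟩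
    _/_ (+ monomial a (x ∷ u)) (n ^ x ℕ.* n ^ sum u) {{m*n≢0 (n ^ x) (n ^ sum u) {{n^x≢0}} {{n^|u|≢0}}}}
      ≡⟨ frac-cong (monomial a (x ∷ u)) (n ^ x ℕ.* n ^ sum u) (monomial a (x ∷ u)) (n ^ (x ℕ.+ sum u))
           {{m*n≢0 (n ^ x) (n ^ sum u) {{n^x≢0}} {{n^|u|≢0}}}} {{m^n≢0 n (x ℕ.+ sum u)}}
           (cong (monomial a (x ∷ u) ℕ.*_) (^-distribˡ-+-* n x (sum u))) ⟩
    _/_ (+ monomial a (x ∷ u)) (n ^ (x ℕ.+ sum u)) {{m^n≢0 n (x ℕ.+ sum u)}} ∎
    where
    F : Fin (suc r) → ℚ
    F i = ((+ a i) / n) ^ℚ lookup (x ∷ u) i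
    n^x≢0 : NonZero (n ^ x)
    n^x≢0 = m^n≢0 n x
    n^|u|≢0 : NonZero (n ^ sum u)
    n^|u|≢0 = m^n≢0 n (sum u)

fraction-identity : ∀ T N D G A M .{{_ : NonZero N}} .{{_ : NonZero G}} .{{_ : NonZero M}} →
  T ℕ.* G ℕ.* M ≡ D ℕ.* A ℕ.* N → ((+ 1) / N) * ℕ→ℚ T ≡ ((+ D) / G) * ((+ A) / M)
fraction-identity T N D G A M {{N≢0}} {{G≢0}} {{M≢0}} cleared = begin
  ((+ 1) / N) * ((+ T) / 1)                 ≡⟨ frac-* 1 N T 1 ⟩
  _/_ (+ (1 ℕ.* T)) (N ℕ.* 1) {{m*n≢0 N 1}} ≡⟨ frac-cong (1 ℕ.* T) (N ℕ.* 1) (D ℕ.* A) (G ℕ.* M) {{m*n≢0 N 1}} {{m*n≢0 G M}} cross ⟩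
  _/_ (+ (D ℕ.* A)) (G ℕ.* M) {{m*n≢0 G M}} ≡⟨ sym (frac-* D G A M) ⟩
  ((+ D) / G) * ((+ A) / M)                 ∎
  where
  reassocˡ : ∀ T G M → 1 ℕ.* T ℕ.* (G ℕ.* M) ≡ T ℕ.* G ℕ.* M
  reassocˡ = solve-∀
  reassocʳ : ∀ D A N → D ℕ.* A ℕ.* N ≡ D ℕ.* A ℕ.* (N ℕ.* 1)
  reassocʳ = solve-∀
  cross : 1 ℕ.* T ℕ.* (G ℕ.* M) ≡ D ℕ.* A ℕ.* (N ℕ.* 1)
  cross = trans (reassocˡ T G M) (trans cleared (reassocʳ D A N))

-- Lemma 2.1: moment-identity divided by u₁!⋯u_r!(d-|u|)! · n^|u| · n^k.
lemma2p1 : (n d k r : ℕ) → .{{_ : NonZero n}} → 1 ≤ k → k ≤ d →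
    (S : List (Vec (Fin n) d)) → IsOA n d k S →
    (c : Fin n → Fin r) →
    (u : Vec ℕ r) → sum u ≤ k →
    _/_ (+ 1) (n ^ k) {{m^n≢0 n k}} * sumℚ (map (λ v → ℕ→ℚ (vecChoose v u) * ℕ→ℚ (s c S v)) (compositions r d))
      ≡ multinom d u * prodℚ (map (λ i → ((+ classSize c i) / n) ^ℚ lookup u i) (allFin r))
lemma2p1 n d k r _ k≤d S oa c u |u|≤k = begin
  1/n^k * sumℚ (map (λ v → ℕ→ℚ (vecChoose v u) * ℕ→ℚ (s c S v)) (compositions r d))
    ≡⟨ cong (1/n^k *_) (sumℚ-ℕ→ℚ (λ v → vecChoose v u) (s c S) (compositions r d)) ⟩
  1/n^k * ℕ→ℚ T
    ≡⟨ fraction-identity T (n ^ k) (d !) G A (n ^ sum u) {{m^n≢0 n k}} {{G≢0}} {{m^n≢0 n (sum u)}} (moment-identity u |u|≤k) ⟩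
  multinom d u * _/_ (+ A) (n ^ sum u) {{m^n≢0 n (sum u)}}
    ≡⟨ cong (multinom d u *_) (sym (prodℚ-powers n (classSize c) u)) ⟩
  multinom d u * prodℚ (map (λ i → ((+ classSize c i) / n) ^ℚ lookup u i) (allFin r)) ∎
  where
  open Colouring.OrthogonalArray c S oa k≤d
  1/n^k : ℚ
  1/n^k = _/_ (+ 1) (n ^ k) {{m^n≢0 n k}}
  T G A : ℕ
  T = ∑ (compositions r d) (λ v → vecChoose v u ℕ.* s c S v)
  G = factProd u ℕ.* (d ∸ sum u) !
  A = monomial (classSize c) u
  G≢0 : NonZero G
  G≢0 = m*n≢0 (factProd u) ((d ∸ sum u) !) {{factProd-nz {u = u}}} {{(d ∸ sum u) !≢0}}
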